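{- Let $\mathcal{C}$ be any collection of graphs such that every member of $\mathcal{C}$ contains an odd cycle. Then $Forb(\mathcal{C})$ is not $(\delta,\chi_{FF})$-bounded. In particular, $Forb(K_3)$ is not $(\delta,\chi_{FF})$-bounded.
   Context: All graphs are finite, simple and undirected. For a set $\mathcal{C}$ of graphs, $Forb(\mathcal{C})$ is the class of graphs containing no member of $\mathcal{C}$ as an induced subgraph. $\delta(G)$ is the minimum degree of $G$. A Grundy $k$-coloring of $G$ is a proper coloring with colors $\{1,\dots,k\}$ such that for any $i<j$, every vertex colored $j$ has a neighbor colored $i$; $\chi_{FF}(G)$ (the First-Fit or Grundy chromatic number) is the largest $k$ for which a Grundy $k$-coloring exists. A family $\mathcal{F}$ of graphs is $(\delta,\chi_{FF})$-bounded if there is a function $f$ with $f(x)\to\infty$ as $x\to\infty$ such that $\chi_{FF}(G)\geq f(\delta(G))$ for all $G\in\mathcal{F}$. -}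

module Defs where

open import Data.Nat using (ℕ; zero; suc; _+_; _*_; _≤_; _⊓_)
open import Data.Fin using (Fin; zero; suc; inject₁; fromℕ; toℕ)
open import Data.Bool using (Bool; true; false)
open import Data.List using (List; allFin; filter; length; map; foldr)
open import Data.Product using (Σ; ∃; ∃-syntax; _×_; _,_)
open import Relation.Binary.PropositionalEquality using (_≡_)
open import Relation.Nullary using (¬_)
open import Function.Definitions using (Injective)

record Graph : Set where
  field
    n       : ℕ
    Adj     : Fin n → Fin n → Bool
    sym     : ∀ u v → Adj u v ≡ Adj v u
    irrefl  : ∀ v → Adj v v ≡ false
open Graph public

Vertex : Graph → Set
Vertex G = Fin (n G)

Adjacent : (G : Graph) → Vertex G → Vertex G → Set
Adjacent G u v = Adj G u v ≡ true

countTrue : ∀ {m} → (Fin m → Bool) → ℕ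
countTrue {m} f = length (filter (λ i → f i Data.Bool.≟ true) (allFin m))
  where import Data.Bool

degree : (G : Graph) → Vertex G → ℕ
degree G v = countTrue (Adj G v)

minFin : ∀ m → (Fin (suc m) → ℕ) → ℕ
minFin zero    f = f zero
minFin (suc m) f = f zero ⊓ minFin m (λ i → f (suc i))

-- minimum degree δ(G); convention δ = 0 for the graph with no vertices
δ : Graph → ℕ
δ G with n G | degree G
... | zero  | _   = 0
... | suc m | deg = minFin m deg

InducedSubgraph : Graph → Graph → Set
InducedSubgraph H G =
  Σ (Vertex H → Vertex G) λ φ →
    Injective _≡_ _≡_ φ × (∀ u v → Adj H u v ≡ Adj G (φ u) (φ v))

Forb : (Graph → Set) → Graph → Set
Forb C G = ∀ H → C H → ¬ InducedSubgraph H G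

-- G contains a cycle of length suc m (as a subgraph, not necessarily induced):
-- distinct vertices c 0 , … , c m with c i ~ c (i+1) and c m ~ c 0.
HasCycleOfLength : Graph → ℕ → Set
HasCycleOfLength G zero    = Data.Empty.⊥ where import Data.Empty
HasCycleOfLength G (suc m) =
  Σ (Fin (suc m) → Vertex G) λ c →
    Injective _≡_ _≡_ c ×
    (∀ (i : Fin m) → Adjacent G (c (inject₁ i)) (c (suc i))) ×
    Adjacent G (c (fromℕ m)) (c zero)

HasOddCycle : Graph → Set
HasOddCycle G = ∃[ k ] HasCycleOfLength G (3 + 2 * k)

-- A Grundy k-coloring: colours Fin k (colour i ↔ i+1 in the paper), proper,
-- every colour used (the k colour classes are nonempty), and every vertex of
-- colour j has a neighbour of each colour i < j.
IsGrundyColoring : (G : Graph) (k : ℕ) → (Vertex G → Fin k) → Set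
IsGrundyColoring G k col =
  (∀ u v → Adjacent G u v → ¬ col u ≡ col v) ×
  (∀ (c : Fin k) → ∃[ v ] col v ≡ c) ×
  (∀ v (i : Fin k) → toℕ i Data.Nat.< toℕ (col v) →
     ∃[ u ] (Adjacent G v u × col u ≡ i))
  where import Data.Nat

HasGrundyColoring : Graph → ℕ → Set
HasGrundyColoring G k = ∃[ col ] IsGrundyColoring G k col

-- χ_FF(G) ≥ m  (χ_FF is the largest k with a Grundy k-coloring)
χFF≥ : Graph → ℕ → Set
χFF≥ G m = ∃[ k ] (m ≤ k × HasGrundyColoring G k)

TendsToInfinity : (ℕ → ℕ) → Set
TendsToInfinity f = ∀ M → ∃[ N ] ∀ x → N ≤ x → M ≤ f x

δχFF-Bounded : (Graph → Set) → Set
δχFF-Bounded F =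
  ∃[ f ] (TendsToInfinity f × (∀ G → F G → χFF≥ G (f (δ G))))

K₃ : Graph
K₃ = record { n = 3 ; Adj = adj ; sym = s ; irrefl = ir }
  where
  adj : Fin 3 → Fin 3 → Bool
  adj zero zero = false
  adj (suc zero) (suc zero) = false
  adj (suc (suc zero)) (suc (suc zero)) = false
  adj _ _ = true
  s : ∀ u v → adj u v ≡ adj v u
  s zero zero = Relation.Binary.PropositionalEquality.refl
  s zero (suc zero) = Relation.Binary.PropositionalEquality.refl
  s zero (suc (suc zero)) = Relation.Binary.PropositionalEquality.refl
  s (suc zero) zero = Relation.Binary.PropositionalEquality.refl
  s (suc zero) (suc zero) = Relation.Binary.PropositionalEquality.refl
  s (suc zero) (suc (suc zero)) = Relation.Binary.PropositionalEquality.refl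
  s (suc (suc zero)) zero = Relation.Binary.PropositionalEquality.refl
  s (suc (suc zero)) (suc zero) = Relation.Binary.PropositionalEquality.refl
  s (suc (suc zero)) (suc (suc zero)) = Relation.Binary.PropositionalEquality.refl
  ir : ∀ v → adj v v ≡ false
  ir zero = Relation.Binary.PropositionalEquality.refl
  ir (suc zero) = Relation.Binary.PropositionalEquality.refl
  ir (suc (suc zero)) = Relation.Binary.PropositionalEquality.refl

module Submission where

-- The complete bipartite graphs K_{k,k} are a family of
-- witnesses: δ(K_{k,k}) = k grows without bound, yet χ_FF(K_{k,k}) ≤ 2,
-- and no K_{k,k} contains a graph with an odd cycle as an induced subgraph.
-- Hence any f with χ_FF(G) ≥ f(δ(G)) on Forb(C) stays ≤ 2 on arbitrarily
-- large minimum degrees, contradicting f(x) → ∞.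

open import Defs
open import Data.Bool using (Bool; true; false; not; _xor_)
open import Data.Bool.Properties using (xor-comm; xor-same; not-involutive; not-¬)
open import Data.Fin using (Fin; zero; suc; inject₁; fromℕ; toℕ)
open import Data.List using (length; filter; tabulate)
open import Data.Nat using (ℕ; zero; suc; _+_; _*_; _≤_; _<_; z≤n; s≤s)
open import Data.Nat.GeneralisedArithmetic using (fold)
open import Data.Nat.Properties using (⊓-glb; ≤-trans; ≤-reflexive; n≤1+n; +-suc)
open import Data.Product using (Σ; _×_; _,_)
open import Relation.Binary.PropositionalEquality
  using (_≡_; refl; trans; cong; subst) renaming (sym to ≡-sym)
open import Relation.Nullary using (¬_)

adjacent-sym : (G : Graph) {u v : Vertex G} → Adjacent G u v → Adjacent G v u
adjacent-sym G {u} {v} u~v = trans (Graph.sym G v u) u~v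

χFF≥-mono : ∀ {m m′} (G : Graph) → m′ ≤ m → χFF≥ G m → χFF≥ G m′
χFF≥-mono G m′≤m (k , m≤k , grundy) = k , ≤-trans m′≤m m≤k , grundy

-- If, for every N, F contains a graph of minimum degree ≥ N whose Grundy number is
-- below 3, then no f → ∞ can bound χ_FF from below on F: past the threshold
-- where f ≥ 3 we would get χ_FF ≥ 3.
not-δχFF-Bounded :
  (F : Graph → Set) →
  (∀ N → Σ Graph λ G → F G × N ≤ δ G × ¬ χFF≥ G 3) →
  ¬ δχFF-Bounded F
not-δχFF-Bounded F witnesses (f , f→∞ , bounded)
  with f→∞ 3
... | N , 3≤f with witnesses N
...   | G , G∈F , N≤δG , χFF<3 =
  χFF<3 (χFF≥-mono G (3≤f (δ G) N≤δG) (bounded G G∈F))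

minFin-glb : ∀ {k} m (f : Fin (suc m) → ℕ) → (∀ i → k ≤ f i) → k ≤ minFin m f
minFin-glb zero    f k≤f = k≤f zero
minFin-glb (suc m) f k≤f =
  ⊓-glb (k≤f zero) (minFin-glb m (λ i → f (suc i)) (λ i → k≤f (suc i)))

δ-glb : ∀ {k} (G : Graph) → 0 < n G → (∀ v → k ≤ degree G v) → k ≤ δ G
δ-glb record { n = suc m } _ k≤deg = minFin-glb m _ k≤deg

-- countTrue computed by recursion on the index set, which makes the degree
-- count in K_{k,k} a direct induction.
b2n : Bool → ℕ
b2n true  = 1
b2n false = 0

count : ∀ {m} → (Fin m → Bool) → ℕ
count {zero}  f = 0
count {suc m} f = b2n (f zero) + count (λ i → f (suc i))

count-tabulate : ∀ {A : Set} m (h : Fin m → A) (p : A → Bool) →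
  length (filter (λ a → p a Data.Bool.≟ true) (tabulate h)) ≡ count (λ i → p (h i))
count-tabulate zero    h p = refl
count-tabulate (suc m) h p with p (h zero)
... | true  = cong suc (count-tabulate m (λ i → h (suc i)) p)
... | false = count-tabulate m (λ i → h (suc i)) p

countTrue≡count : ∀ {m} (f : Fin m → Bool) → countTrue f ≡ count f
countTrue≡count {m} f = count-tabulate m (λ i → i) f

ThreeWalksClose : Graph → Set
ThreeWalksClose G = ∀ (a b c d : Vertex G) →
  Adjacent G a b → Adjacent G b c → Adjacent G c d → Adjacent G a d

-- A vertex v of colour 2 has neighbours x, u of colours 0, 1, and u has a
-- neighbour w of colour 0; the walk x – v – u – w makes x ~ w, yet both
-- have colour 0, contradicting properness.
no-Grundy-≥3 : (G : Graph) → ThreeWalksClose G → ∀ k → 3 ≤ k → ¬ HasGrundyColoring G k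
no-Grundy-≥3 G close (suc (suc (suc k))) (s≤s (s≤s (s≤s _)))
             (col , proper , surjective , grundy)
  with surjective (suc (suc zero))
... | v , col-v with grundy v zero (subst (λ c → 0 < toℕ c) (≡-sym col-v) (s≤s z≤n))
                   | grundy v (suc zero) (subst (λ c → 1 < toℕ c) (≡-sym col-v) (s≤s (s≤s z≤n)))
...   | x , v~x , col-x | u , v~u , col-u
        with grundy u zero (subst (λ c → 0 < toℕ c) (≡-sym col-u) (s≤s z≤n))
...     | w , u~w , col-w =
  proper x w (close x v u w (adjacent-sym G v~x) v~u u~w) (trans col-x (≡-sym col-w))

no-χFF≥3 : (G : Graph) → ThreeWalksClose G → ¬ χFF≥ G 3
no-χFF≥3 G close (k , 3≤k , grundy) = no-Grundy-≥3 G close k 3≤k grundy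

ProperTwoColouring : (H : Graph) → (Vertex H → Bool) → Set
ProperTwoColouring H s = ∀ u v → Adjacent H u v → s v ≡ not (s u)

fold-not-even : ∀ k b → fold b not (2 * k) ≡ b
fold-not-even zero    b = refl
fold-not-even (suc k) b rewrite +-suc k (k + 0) =
  trans (not-involutive _) (fold-not-even k b)

alternating-last : ∀ m (g : Fin (suc m) → Bool) →
  (∀ (i : Fin m) → g (suc i) ≡ not (g (inject₁ i))) →
  g (fromℕ m) ≡ fold (g zero) not m
alternating-last zero    g flip = refl
alternating-last (suc m) g flip =
  trans (flip (fromℕ m))
        (cong not (alternating-last m (λ i → g (inject₁ i)) (λ i → flip (inject₁ i))))

-- Going round a cycle of even length 2k+2 flips the colour of c 0 an even
-- number of times, so the closing edge joins two vertices of equal colour.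
two-colourable⇒no-odd-cycle :
  (H : Graph) (s : Vertex H → Bool) → ProperTwoColouring H s → ¬ HasOddCycle H
two-colourable⇒no-odd-cycle H s proper (k , c , _ , steps , closing) =
  not-¬ refl (trans last≡first (proper _ _ closing))
  where
  m = suc (suc (2 * k))
  colour : Fin (suc m) → Bool
  colour i = s (c i)

  last≡first : colour (fromℕ m) ≡ colour zero
  last≡first = trans (alternating-last m colour (λ i → proper _ _ (steps i)))
                     (trans (not-involutive _) (fold-not-even k (colour zero)))

induced-two-colouring : (H G : Graph) (s : Vertex G → Bool) →
  ProperTwoColouring G s → ((φ , _) : InducedSubgraph H G) →
  ProperTwoColouring H (λ v → s (φ v))
induced-two-colouring H G s proper (φ , _ , preserves) u v u~v =
  proper (φ u) (φ v) (trans (≡-sym (preserves u v)) u~v)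

completeBipartite : ∀ m → (Fin m → Bool) → Graph
completeBipartite m side = record
  { n      = m
  ; Adj    = λ u v → side u xor side v
  ; sym    = λ u v → xor-comm (side u) (side v)
  ; irrefl = λ v → xor-same (side v)
  }

-- Adjacency in a complete bipartite graph, read as a 2-colouring and as
-- closure of 3-edge walks (odd + odd + odd label changes is odd).
xor≡true⇒not : ∀ a b → a xor b ≡ true → b ≡ not a
xor≡true⇒not true  false _ = refl
xor≡true⇒not false true  _ = refl

xor-three-step : ∀ a b c d →
  a xor b ≡ true → b xor c ≡ true → c xor d ≡ true → a xor d ≡ true
xor-three-step true  false true  false _ _ _ = refl
xor-three-step false true  false true  _ _ _ = refl
xor-three-step true  true  _     _     ()
xor-three-step false false _     _     ()
xor-three-step _     true  true  _     _ ()
xor-three-step _     false false _     _ ()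
xor-three-step _     _     true  true  _ _ ()
xor-three-step _     _     false false _ _ ()

completeBipartite-two-colouring : ∀ m (side : Fin m → Bool) →
  ProperTwoColouring (completeBipartite m side) side
completeBipartite-two-colouring m side u v = xor≡true⇒not (side u) (side v)

completeBipartite-three-walks : ∀ m (side : Fin m → Bool) →
  ThreeWalksClose (completeBipartite m side)
completeBipartite-three-walks m side a b c d =
  xor-three-step (side a) (side b) (side c) (side d)

completeBipartite-∈-Forb : ∀ m (side : Fin m → Bool) (C : Graph → Set) →
  (∀ H → C H → HasOddCycle H) → Forb C (completeBipartite m side)
completeBipartite-∈-Forb m side C odd H H∈C H⊆G =
  two-colourable⇒no-odd-cycle H _
    (induced-two-colouring H (completeBipartite m side) side
      (completeBipartite-two-colouring m side) H⊆G)
    (odd H H∈C)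

double : ℕ → ℕ
double zero    = zero
double (suc k) = suc (suc (double k))

alternate : ∀ k → Fin (double k) → Bool
alternate (suc k) zero          = true
alternate (suc k) (suc zero)    = false
alternate (suc k) (suc (suc i)) = alternate k i

K : ℕ → Graph
K k = completeBipartite (double k) (alternate k)

-- Each label occurs k times, so exactly k vertices carry a label ≠ b.
count-other-side : ∀ k b → count (λ u → b xor alternate k u) ≡ k
count-other-side zero    b     = refl
count-other-side (suc k) true  = cong suc (count-other-side k true)
count-other-side (suc k) false = cong suc (count-other-side k false)

δ-K : ∀ k → suc k ≤ δ (K (suc k))
δ-K k = δ-glb (K (suc k)) (s≤s z≤n) λ v → ≤-reflexive (≡-sym (
  trans (countTrue≡count (λ u → alternate (suc k) v xor alternate (suc k) u))
        (count-other-side (suc k) (alternate (suc k) v))))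

Forb-odd-not-bounded :
  (C : Graph → Set) → (∀ H → C H → HasOddCycle H) → ¬ δχFF-Bounded (Forb C)
Forb-odd-not-bounded C odd = not-δχFF-Bounded (Forb C) λ N →
  K (suc N) ,
  completeBipartite-∈-Forb (double (suc N)) (alternate (suc N)) C odd ,
  ≤-trans (n≤1+n N) (δ-K N) ,
  no-χFF≥3 (K (suc N)) (completeBipartite-three-walks _ (alternate (suc N)))

K₃-odd-cycle : HasOddCycle K₃
K₃-odd-cycle = 0 , (λ i → i) , (λ eq → eq) , (λ { zero → refl ; (suc zero) → refl }) , refl

proposition2 :
    ((C : Graph → Set) → (∀ H → C H → HasOddCycle H) → ¬ δχFF-Bounded (Forb C))
    × ¬ δχFF-Bounded (Forb (λ H → H ≡ K₃))
proposition2 =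
  Forb-odd-not-bounded ,
  Forb-odd-not-bounded (λ H → H ≡ K₃) (λ H H≡K₃ → subst HasOddCycle (≡-sym H≡K₃) K₃-odd-cycle)
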